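{- Let $(M,\exists)$ be a monadic algebra and $\Upsilon$ a ubiquity operator on it. Then for all $p\in M$, $\Upsilon p\le(\Upsilon p')'$.
   Context: A monadic algebra is a Boolean algebra $M$ (operations $\wedge,\vee,{}'$, constants $0,1$, order $\le$) together with a map $\exists:M\to M$ such that $\exists 0=0$, $p\le\exists p$, and $\exists(p\wedge\exists q)=\exists p\wedge\exists q$ for all $p,q$. Write $\forall p:=(\exists p')'$. A ubiquity operator on $M$ is a map $\Upsilon:M\to M$ such that for all $p,q\in M$: (i) $\Upsilon p\wedge\Upsilon q\le\Upsilon(p\wedge q)$; (ii) $\Upsilon p\le\Upsilon(p\vee q)$; (iii) $\forall p\le\Upsilon p\le\exists p$. -}

module Defs where

open import Level using (Level; _⊔_)
open import Algebra.Lattice.Bundles using (BooleanAlgebra)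

module BAOrder {c ℓ : Level} (B : BooleanAlgebra c ℓ) where
  open BooleanAlgebra B
  infix 4 _≤_
  _≤_ : Carrier → Carrier → Set ℓ
  x ≤ y = (x ∧ y) ≈ x

record IsMonadic {c ℓ : Level} (B : BooleanAlgebra c ℓ)
                 (ex : BooleanAlgebra.Carrier B → BooleanAlgebra.Carrier B) : Set (c ⊔ ℓ) where
  open BooleanAlgebra B
  open BAOrder B
  field
    ex-cong  : ∀ {p q} → p ≈ q → ex p ≈ ex q
    ex-⊥     : ex ⊥ ≈ ⊥
    ex-incr  : ∀ p → p ≤ ex p
    ex-quasi : ∀ p q → ex (p ∧ ex q) ≈ (ex p ∧ ex q)

module _ {c ℓ : Level} (B : BooleanAlgebra c ℓ) where
  open BooleanAlgebra B
  univ : (Carrier → Carrier) → Carrier → Carrier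
  univ ex p = ¬ (ex (¬ p))

record IsUbiquity {c ℓ : Level} (B : BooleanAlgebra c ℓ)
                  (ex : BooleanAlgebra.Carrier B → BooleanAlgebra.Carrier B)
                  (U : BooleanAlgebra.Carrier B → BooleanAlgebra.Carrier B) : Set (c ⊔ ℓ) where
  open BooleanAlgebra B
  open BAOrder B
  field
    U-cong  : ∀ {p q} → p ≈ q → U p ≈ U q
    U-meet  : ∀ p q → (U p ∧ U q) ≤ U (p ∧ q)
    U-mono  : ∀ p q → U p ≤ U (p ∨ q)
    U-lower : ∀ p → univ B ex p ≤ U p
    U-upper : ∀ p → U p ≤ ex p

-- U p and U p' are disjoint: their meet lies below U (p ∧ p') = U 0 ≤ ∃ 0 = 0.
-- In a Boolean algebra an element disjoint from y lies below y'.
module Submission where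

open import Defs
open import Level using (Level)
open import Algebra.Lattice.Bundles using (BooleanAlgebra)
import Algebra.Lattice.Properties.BooleanAlgebra as BooleanAlgebraProperties
import Relation.Binary.Reasoning.Setoid as SetoidReasoning

module DisjointProperties {c ℓ : Level} (B : BooleanAlgebra c ℓ) where
  open BooleanAlgebra B
  open BooleanAlgebraProperties B
  open BAOrder B
  open SetoidReasoning setoid

  disjoint⇒≤¬ : ∀ {x y} → x ∧ y ≈ ⊥ → x ≤ ¬ y
  disjoint⇒≤¬ {x} {y} x∧y≈⊥ = begin
    x ∧ ¬ y               ≈⟨ ∨-identityʳ _ ⟨
    (x ∧ ¬ y) ∨ ⊥         ≈⟨ ∨-congˡ x∧y≈⊥ ⟨
    (x ∧ ¬ y) ∨ (x ∧ y)   ≈⟨ ∧-distribˡ-∨ x (¬ y) y ⟨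
    x ∧ (¬ y ∨ y)         ≈⟨ ∧-congˡ (∨-complementˡ y) ⟩
    x ∧ ⊤                 ≈⟨ ∧-identityʳ x ⟩
    x                     ∎

  ≤⊥⇒≈⊥ : ∀ {x} → x ≤ ⊥ → x ≈ ⊥
  ≤⊥⇒≈⊥ {x} x≤⊥ = trans (sym x≤⊥) (∧-zeroʳ x)

module UbiquityProperties {c ℓ : Level} (B : BooleanAlgebra c ℓ)
  {ex U : BooleanAlgebra.Carrier B → BooleanAlgebra.Carrier B}
  (monadic : IsMonadic B ex) (ubiquity : IsUbiquity B ex U) where
  open BooleanAlgebra B
  open BAOrder B
  open DisjointProperties B
  open IsMonadic monadic
  open IsUbiquity ubiquity
  open SetoidReasoning setoid

  U-⊥ : U ⊥ ≈ ⊥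
  U-⊥ = ≤⊥⇒≈⊥ (begin
    U ⊥ ∧ ⊥      ≈⟨ ∧-congˡ ex-⊥ ⟨
    U ⊥ ∧ ex ⊥   ≈⟨ U-upper ⊥ ⟩
    U ⊥          ∎)

  U-disjoint-¬ : ∀ p → U p ∧ U (¬ p) ≈ ⊥
  U-disjoint-¬ p = ≤⊥⇒≈⊥ (begin
    (U p ∧ U (¬ p)) ∧ ⊥             ≈⟨ ∧-congˡ U-⊥ ⟨
    (U p ∧ U (¬ p)) ∧ U ⊥           ≈⟨ ∧-congˡ (U-cong (∧-complementʳ p)) ⟨
    (U p ∧ U (¬ p)) ∧ U (p ∧ ¬ p)   ≈⟨ U-meet p (¬ p) ⟩
    U p ∧ U (¬ p)                   ∎)

mainTheorem7 : {c ℓ : Level} (B : BooleanAlgebra c ℓ)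
    (ex U : BooleanAlgebra.Carrier B → BooleanAlgebra.Carrier B) →
    IsMonadic B ex → IsUbiquity B ex U →
    (p : BooleanAlgebra.Carrier B) →
    BAOrder._≤_ B (U p) (BooleanAlgebra.¬_ B (U (BooleanAlgebra.¬_ B p)))
mainTheorem7 B ex U monadic ubiquity p =
  DisjointProperties.disjoint⇒≤¬ B (UbiquityProperties.U-disjoint-¬ B monadic ubiquity p)
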